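{- Let $R$ be a finite group, $Q$ a subgroup of $R$, and $QxQ$ an inverse-closed double coset with $|QxQ|=b|Q|$. Let $\mathcal{M}$ be the set of inverse-closed subsets $S\subseteq QxQ$ that intersect $QxQ$ evenly. Then $|\mathcal{M}|\leq 2^{\mathbf{c}(QxQ)-\frac12 b+\frac12}$.
   Context: $\mathcal{I}(X)$ is the set of elements of $X$ of order at most $2$ and $\mathbf{c}(X)=(|X|+|\mathcal{I}(X)|)/2$. A subset $S$ is inverse-closed if $S=S^{ -1}$. If $\Delta$ is a union of right $Q$-cosets $\Lambda_1,\dots,\Lambda_b$, then $S$ intersects $\Delta$ evenly if $|S\cap\Lambda_1|=\dots=|S\cap\Lambda_b|$. -}

module Defs where

open import Data.Nat using (ℕ; _+_; _*_; _∸_; _^_; _≤_)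
open import Data.Fin using (Fin)
open import Data.Fin.Properties using (any?)
open import Data.Fin.Subset using (Subset; _∈_; _⊆_; _∩_; ∣_∣)
open import Data.Fin.Subset.Properties using (_∈?_)
open import Data.Vec using (tabulate)
open import Data.Product using (Σ; _×_; _,_)
open import Relation.Nullary using (Dec; does)
open import Relation.Nullary.Decidable using (_×-dec_)
open import Relation.Binary.PropositionalEquality using (_≡_)
open import Data.Fin using (_≟_)

-- A finite group, presented (up to isomorphism) on the carrier Fin n.
record FinGroup : Set where
  infixl 7 _·_
  field
    n      : ℕ
    _·_    : Fin n → Fin n → Fin n
    e      : Fin n
    inv    : Fin n → Fin n
    assoc  : ∀ a b c → (a · b) · c ≡ a · (b · c)
    idˡ    : ∀ a → e · a ≡ a
    idʳ    : ∀ a → a · e ≡ a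
    invˡ   : ∀ a → inv a · a ≡ e
    invʳ   : ∀ a → a · inv a ≡ e

module _ (G : FinGroup) where
  open FinGroup G

  IsSubgroup : Subset n → Set
  IsSubgroup Q = (e ∈ Q)
               × (∀ a b → a ∈ Q → b ∈ Q → a · b ∈ Q)
               × (∀ a → a ∈ Q → inv a ∈ Q)

  inDoubleCoset? : (Q : Subset n) (x g : Fin n) →
    Dec (Σ (Fin n) λ q → Σ (Fin n) λ q' → (q ∈ Q) × (q' ∈ Q) × (g ≡ q · x · q'))
  inDoubleCoset? Q x g =
    any? λ q → any? λ q' → (q ∈? Q) ×-dec ((q' ∈? Q) ×-dec (g ≟ q · x · q'))

  DoubleCoset : Subset n → Fin n → Subset n
  DoubleCoset Q x = tabulate λ g → does (inDoubleCoset? Q x g)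

  inRightCoset? : (Q : Subset n) (y g : Fin n) →
    Dec (Σ (Fin n) λ q → (q ∈ Q) × (g ≡ q · y))
  inRightCoset? Q y g = any? λ q → (q ∈? Q) ×-dec (g ≟ q · y)

  RightCoset : Subset n → Fin n → Subset n
  RightCoset Q y = tabulate λ g → does (inRightCoset? Q y g)

  Invols : Subset n → Subset n
  Invols X = tabulate λ g → does ((g ∈? X) ×-dec (g · g ≟ e))

  -- 2·𝐜(X) = |X| + |𝓘(X)|
  twiceC : Subset n → ℕ
  twiceC X = ∣ X ∣ + ∣ Invols X ∣

  InverseClosed : Subset n → Set
  InverseClosed S = ∀ g → (g ∈ S → inv g ∈ S) × (inv g ∈ S → g ∈ S)

  IntersectsEvenly : (Q Δ S : Subset n) → Set
  IntersectsEvenly Q Δ S = ∀ y z → y ∈ Δ → z ∈ Δ →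
    ∣ S ∩ RightCoset Q y ∣ ≡ ∣ S ∩ RightCoset Q z ∣

  In𝓜 : (Q : Subset n) (x : Fin n) → Subset n → Set
  In𝓜 Q x S = (S ⊆ DoubleCoset Q x) × InverseClosed S
             × IntersectsEvenly Q (DoubleCoset Q x) S

-- Write Δ = QxQ and g ~ h when Qg = Qh. Since x⁻¹ ∈ Δ, every right coset Qh ⊆ Δ contains an
-- element r with r² ∈ Q, i.e. with r⁻¹ ∈ Qr; the least such r (in the order of Fin n) represents
-- Qh. As Δ ⊆ Q · reps there are at least b representatives; those outside Qx are the pivots.
-- Picking the smaller element of every pair {g, g⁻¹} ⊆ Δ gives 𝐜(Δ) elements, among them all
-- pivots; the others are the free elements, so 2|free| ≤ 2𝐜(Δ) − 2|pivots| ≤ 2𝐜(Δ) + 1 − b.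
-- A set S ∈ 𝓜 is determined by S ∩ free: inverse-closure fixes S at every g such that neither
-- g nor g⁻¹ is a pivot, in particular on all of Qx; then evenness, |S ∩ Qd| = |S ∩ Qx|, decides
-- whether a pivot d lies in S, the rest of Qd being fixed already (d⁻¹ ∈ Qd goes with d).

module Submission where

open import Defs
open import Algebra.Bundles using (Group)
import Algebra.Properties.Group as GroupProperties
open import Data.Nat using (ℕ; suc; _+_; _*_; _∸_; _^_; _≤_; z≤n; s≤s; >-nonZero)
import Data.Nat.Properties as ℕ
open import Data.Nat.Properties
  using (+-suc; +-identityʳ; ≤-trans; ≤-reflexive; m≤m+n; *-comm; *-mono-≤; +-monoʳ-≤; +-monoˡ-≤; +-mono-≤;
         *-cancelʳ-≤; m+n≤o⇒m≤o∸n; ^-distribˡ-+-*; ^-monoʳ-≤; module ≤-Reasoning)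
open import Data.Nat.Tactic.RingSolver using (solve-∀)
open import Data.Bool using (true)
open import Data.Fin using (Fin; zero; suc; inject; fromℕ<; _≟_) renaming (_≤_ to _≤ᶠ_; _<_ to _<ᶠ_)
open import Data.Fin.Properties
  using (suc-injective; ¬∀⟶∃¬-smallest; toℕ-injective; toℕ-inject; toℕ-fromℕ<; all?; <-cmp; ≤-antisym)
  renaming (_≤?_ to _≤ᶠ?_; _<?_ to _<ᶠ?_)
open import Data.Fin.Subset
  using (Subset; inside; outside; _∈_; _∉_; _⊆_; _⊂_; _∪_; _∩_; ∣_∣; Empty; ⁅_⁆)
open import Data.Fin.Subset.Properties
  using (_∈?_; drop-∷-⊆; Empty-unique; ∣⊥∣≡0; x∈p∪q⁻; x∈p∪q⁺; x∈p∩q⁺; x∈p∩q⁻; p∩q⊆q; ⊆-antisym;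
         p⊆q⇒∣p∣≤∣q∣; p⊂q⇒∣p∣<∣q∣; x∈⁅x⁆; ∣⁅x⁆∣≡1; x∈p⇒∣p-x∣<∣p∣)
open import Data.Vec using ([]; _∷_; here; there; tabulate)
open import Data.Vec.Properties using (lookup∘tabulate; []=⇒lookup; lookup⇒[]=)
open import Data.List using (List; []; _∷_; [_]; _++_; map; length; cartesianProductWith)
open import Data.List.Properties using (length-++; length-map)
open import Data.List.Membership.Propositional using () renaming (_∈_ to _∈ₗ_)
open import Data.List.Membership.Propositional.Properties
  using (∈-∃++; ∈-++⁻; ∈-++⁺ˡ; ∈-++⁺ʳ; ∈-map⁺; ∈-map⁻; ∈-cartesianProductWith⁺)
open import Data.List.Relation.Binary.Subset.Propositional using () renaming (_⊆_ to _⊆ₗ_)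
open import Data.List.Relation.Unary.Any using (here; there)
open import Data.List.Relation.Unary.All as All using (All)
import Data.List.Relation.Unary.All.Properties as All
open import Data.List.Relation.Unary.AllPairs using ([]; _∷_)
open import Data.List.Relation.Unary.Unique.Propositional using (Unique)
open import Data.List.Relation.Unary.Unique.Propositional.Properties using (map⁺)
open import Data.Product using (∃; _×_; _,_; proj₁; proj₂)
open import Data.Sum using (_⊎_; inj₁; inj₂)
open import Function using (_∘_; id)
open import Level using (Level)
open import Relation.Binary.Definitions using (tri<; tri≈; tri>)
open import Relation.Binary.PropositionalEquality
  using (_≡_; _≢_; refl; sym; trans; cong; cong₂; subst; isEquivalence; module ≡-Reasoning)
open import Relation.Nullary using (¬_; Dec; does; proof; yes; no; ¬?; Reflects; invert; contradiction)
open import Relation.Nullary.Decidable using (dec-true; decidable-stable; _×-dec_; _→-dec_)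
open import Relation.Unary using (Pred; Decidable)

private variable
  ℓ : Level
  A B C : Set
  k : ℕ

-- Counting with lists and finite subsets

∈-removeMiddle : ∀ {v w : A} us {vs} → v ∈ₗ us ++ w ∷ vs → v ≢ w → v ∈ₗ us ++ vs
∈-removeMiddle us v∈ v≢w with ∈-++⁻ us v∈
... | inj₁ v∈us         = ∈-++⁺ˡ v∈us
... | inj₂ (here v≡w)   = contradiction v≡w v≢w
... | inj₂ (there v∈vs) = ∈-++⁺ʳ us v∈vs

Unique-⊆⇒length≤ : {xs ys : List A} → Unique xs → xs ⊆ₗ ys → length xs ≤ length ys
Unique-⊆⇒length≤ {xs = []} _ _ = z≤n
Unique-⊆⇒length≤ {xs = x ∷ xs} (x∉xs ∷ xs!) xs⊆ys with ∈-∃++ (xs⊆ys (here refl))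
... | us , vs , refl = ≤-trans
  (s≤s (Unique-⊆⇒length≤ xs! λ y∈xs →
    ∈-removeMiddle us (xs⊆ys (there y∈xs)) (λ y≡x → All.lookup x∉xs y∈xs (sym y≡x))))
  (≤-reflexive (sym (length-insert us)))
  where
  length-insert : ∀ {v : A} us {vs} → length (us ++ v ∷ vs) ≡ suc (length (us ++ vs))
  length-insert []       = refl
  length-insert (u ∷ us) = cong suc (length-insert us)

map⁺-injectiveOn : ∀ {f : A → B} {xs} → (∀ {x y} → x ∈ₗ xs → y ∈ₗ xs → f x ≡ f y → x ≡ y) →
                   Unique xs → Unique (map f xs)
map⁺-injectiveOn {xs = []}     _   []           = []
map⁺-injectiveOn {xs = x ∷ xs} inj (x∉xs ∷ xs!) =
  All.map⁺ (All.tabulate λ y∈xs fx≡fy → All.lookup x∉xs y∈xs (inj (here refl) (there y∈xs) fx≡fy))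
  ∷ map⁺-injectiveOn (λ x∈ y∈ → inj (there x∈) (there y∈)) xs!

length-cartesianProductWith : (f : A → B → C) (xs : List A) (ys : List B) →
  length (cartesianProductWith f xs ys) ≡ length xs * length ys
length-cartesianProductWith f []       ys = refl
length-cartesianProductWith f (x ∷ xs) ys = trans (length-++ (map (f x) ys))
  (cong₂ _+_ (length-map (f x) ys) (length-cartesianProductWith f xs ys))

subsetsOf : Subset k → List (Subset k)
subsetsOf []            = [ [] ]
subsetsOf (inside ∷ p)  = map (inside ∷_) (subsetsOf p) ++ map (outside ∷_) (subsetsOf p)
subsetsOf (outside ∷ p) = map (outside ∷_) (subsetsOf p)

length-subsetsOf : (p : Subset k) → length (subsetsOf p) ≡ 2 ^ ∣ p ∣
length-subsetsOf []            = refl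
length-subsetsOf (inside ∷ p)  = begin
  length (map (inside ∷_) (subsetsOf p) ++ map (outside ∷_) (subsetsOf p))
    ≡⟨ length-++ (map (inside ∷_) (subsetsOf p)) ⟩
  length (map (inside ∷_) (subsetsOf p)) + length (map (outside ∷_) (subsetsOf p))
    ≡⟨ cong₂ _+_ (length-map _ (subsetsOf p)) (length-map _ (subsetsOf p)) ⟩
  length (subsetsOf p) + length (subsetsOf p)
    ≡⟨ cong₂ _+_ (length-subsetsOf p) (trans (length-subsetsOf p) (sym (+-identityʳ _))) ⟩
  2 ^ ∣ p ∣ + (2 ^ ∣ p ∣ + 0) ∎
  where open ≡-Reasoning
length-subsetsOf (outside ∷ p) = trans (length-map _ (subsetsOf p)) (length-subsetsOf p)

∈-subsetsOf : {p q : Subset k} → q ⊆ p → q ∈ₗ subsetsOf p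
∈-subsetsOf {p = []}          {[]}          _ = here refl
∈-subsetsOf {p = inside ∷ p}  {inside ∷ q}  q⊆p =
  ∈-++⁺ˡ (∈-map⁺ _ (∈-subsetsOf (drop-∷-⊆ q⊆p)))
∈-subsetsOf {p = inside ∷ p}  {outside ∷ q} q⊆p =
  ∈-++⁺ʳ (map (inside ∷_) (subsetsOf p)) (∈-map⁺ _ (∈-subsetsOf (drop-∷-⊆ q⊆p)))
∈-subsetsOf {p = outside ∷ p} {outside ∷ q} q⊆p = ∈-map⁺ _ (∈-subsetsOf (drop-∷-⊆ q⊆p))
∈-subsetsOf {p = outside ∷ p} {inside ∷ q}  q⊆p with () ← q⊆p here

elements : Subset k → List (Fin k)
elements []            = []
elements (inside ∷ p)  = zero ∷ map suc (elements p)
elements (outside ∷ p) = map suc (elements p)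

length-elements : (p : Subset k) → length (elements p) ≡ ∣ p ∣
length-elements []            = refl
length-elements (inside ∷ p)  = cong suc (trans (length-map suc (elements p)) (length-elements p))
length-elements (outside ∷ p) = trans (length-map suc (elements p)) (length-elements p)

∈-elements⁺ : {p : Subset k} {i : Fin k} → i ∈ p → i ∈ₗ elements p
∈-elements⁺ {p = inside ∷ p}  here         = here refl
∈-elements⁺ {p = inside ∷ p}  (there i∈p)  = there (∈-map⁺ suc (∈-elements⁺ i∈p))
∈-elements⁺ {p = outside ∷ p} (there i∈p)  = ∈-map⁺ suc (∈-elements⁺ i∈p)

∈-elements⁻ : {p : Subset k} {i : Fin k} → i ∈ₗ elements p → i ∈ p
∈-elements⁻ {p = inside ∷ p}  (here refl) = here
∈-elements⁻ {p = inside ∷ p}  (there i∈) with _ , j∈ , refl ← ∈-map⁻ suc i∈ = there (∈-elements⁻ j∈)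
∈-elements⁻ {p = outside ∷ p} i∈         with _ , j∈ , refl ← ∈-map⁻ suc i∈ = there (∈-elements⁻ j∈)

Unique-elements : (p : Subset k) → Unique (elements p)
Unique-elements []            = []
Unique-elements (inside ∷ p)  =
  All.map⁺ (All.universal (λ _ ()) (elements p)) ∷ map⁺ suc-injective (Unique-elements p)
Unique-elements (outside ∷ p) = map⁺ suc-injective (Unique-elements p)

∣p∣≤length : ∀ {p : Subset k} {f : Fin k → A} {ys} →
  (∀ {i j} → i ∈ p → j ∈ p → f i ≡ f j → i ≡ j) → (∀ {i} → i ∈ p → f i ∈ₗ ys) →
  ∣ p ∣ ≤ length ys
∣p∣≤length {p = p} {f} {ys} inj into = begin
  ∣ p ∣                        ≡⟨ length-elements p ⟨
  length (elements p)          ≡⟨ length-map f (elements p) ⟨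
  length (map f (elements p))  ≤⟨ Unique-⊆⇒length≤ image-Unique image⊆ ⟩
  length ys                    ∎
  where
  open ≤-Reasoning
  image-Unique : Unique (map f (elements p))
  image-Unique = map⁺-injectiveOn (λ i∈ j∈ → inj (∈-elements⁻ i∈) (∈-elements⁻ j∈)) (Unique-elements p)
  image⊆ : map f (elements p) ⊆ₗ ys
  image⊆ fi∈ with _ , i∈ , refl ← ∈-map⁻ f fi∈ = into (∈-elements⁻ i∈)

∣p∪q∣+∣p∩q∣≡∣p∣+∣q∣ : (p q : Subset k) → ∣ p ∪ q ∣ + ∣ p ∩ q ∣ ≡ ∣ p ∣ + ∣ q ∣
∣p∪q∣+∣p∩q∣≡∣p∣+∣q∣ []            []            = refl
∣p∪q∣+∣p∩q∣≡∣p∣+∣q∣ (inside  ∷ p) (inside  ∷ q) =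
  cong suc (trans (+-suc _ _) (trans (cong suc (∣p∪q∣+∣p∩q∣≡∣p∣+∣q∣ p q)) (sym (+-suc _ _))))
∣p∪q∣+∣p∩q∣≡∣p∣+∣q∣ (inside  ∷ p) (outside ∷ q) = cong suc (∣p∪q∣+∣p∩q∣≡∣p∣+∣q∣ p q)
∣p∪q∣+∣p∩q∣≡∣p∣+∣q∣ (outside ∷ p) (inside  ∷ q) =
  trans (cong suc (∣p∪q∣+∣p∩q∣≡∣p∣+∣q∣ p q)) (sym (+-suc _ _))
∣p∪q∣+∣p∩q∣≡∣p∣+∣q∣ (outside ∷ p) (outside ∷ q) = ∣p∪q∣+∣p∩q∣≡∣p∣+∣q∣ p q

∣p∪q∣≤∣p∣+∣q∣ : (p q : Subset k) → ∣ p ∪ q ∣ ≤ ∣ p ∣ + ∣ q ∣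
∣p∪q∣≤∣p∣+∣q∣ p q = ≤-trans (m≤m+n _ _) (≤-reflexive (∣p∪q∣+∣p∩q∣≡∣p∣+∣q∣ p q))

∪-lub : {p q r : Subset k} → p ⊆ r → q ⊆ r → p ∪ q ⊆ r
∪-lub {p = p} {q} p⊆r q⊆r i∈p∪q with x∈p∪q⁻ p q i∈p∪q
... | inj₁ i∈p = p⊆r i∈p
... | inj₂ i∈q = q⊆r i∈q

disjoint⇒∣p∣+∣q∣≤∣r∣ : {p q r : Subset k} → Empty (p ∩ q) → p ⊆ r → q ⊆ r → ∣ p ∣ + ∣ q ∣ ≤ ∣ r ∣
disjoint⇒∣p∣+∣q∣≤∣r∣ {k = k} {p} {q} {r} p∩q-empty p⊆r q⊆r = begin
  ∣ p ∣ + ∣ q ∣             ≡⟨ ∣p∪q∣+∣p∩q∣≡∣p∣+∣q∣ p q ⟨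
  ∣ p ∪ q ∣ + ∣ p ∩ q ∣     ≡⟨ cong (∣ p ∪ q ∣ +_) (trans (cong ∣_∣ (Empty-unique p∩q-empty)) (∣⊥∣≡0 k)) ⟩
  ∣ p ∪ q ∣ + 0             ≡⟨ +-identityʳ _ ⟩
  ∣ p ∪ q ∣                 ≤⟨ p⊆q⇒∣p∣≤∣q∣ (∪-lub p⊆r q⊆r) ⟩
  ∣ r ∣                     ∎
  where open ≤-Reasoning

-- `RightCoset`, `DoubleCoset` and `Invols` from `Defs` are definitionally of this form.
decSubset : {P : Pred (Fin k) ℓ} → Decidable P → Subset k
decSubset P? = tabulate (does ∘ P?)

module _ {P : Pred (Fin k) ℓ} (P? : Decidable P) {i : Fin k} where

  ∈-decSubset⁺ : P i → i ∈ decSubset P?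
  ∈-decSubset⁺ Pi = lookup⇒[]= i _ (trans (lookup∘tabulate _ i) (dec-true (P? i) Pi))

  ∈-decSubset⁻ : i ∈ decSubset P? → P i
  ∈-decSubset⁻ i∈ = invert (subst (Reflects (P i)) does≡true (proof (P? i)))
    where
    does≡true : does (P? i) ≡ true
    does≡true = trans (sym (lookup∘tabulate _ i)) ([]=⇒lookup i∈)

least-witness : {P : Pred (Fin k) ℓ} → Decidable P → ∃ P → ∃ λ i → P i × (∀ {j} → j <ᶠ i → ¬ P j)
least-witness {k = k} {P = P} P? (i , Pi)
  with m , ¬¬Pm , below ← ¬∀⟶∃¬-smallest k (¬_ ∘ P) (¬? ∘ P?) (λ ∀¬P → ∀¬P i Pi) =
  m , decidable-stable (P? m) ¬¬Pm , λ j<m → subst (¬_ ∘ P) (inject-fromℕ< j<m) (below (fromℕ< j<m))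
  where
  inject-fromℕ< : ∀ {m j : Fin k} (j<m : j <ᶠ m) → inject {i = m} (fromℕ< j<m) ≡ j
  inject-fromℕ< j<m = toℕ-injective (trans (toℕ-inject (fromℕ< j<m)) (toℕ-fromℕ< j<m))

-- Right cosets

toGroup : FinGroup → Group _ _
toGroup G = record
  { _≈_     = _≡_
  ; _∙_     = _·_
  ; ε       = e
  ; _⁻¹     = inv
  ; isGroup = record
    { isMonoid = record
      { isSemigroup = record
        { isMagma = record { isEquivalence = isEquivalence ; ∙-cong = cong₂ _·_ }
        ; assoc   = assoc
        }
      ; identity = idˡ , idʳ
      }
    ; inverse = invˡ , invʳ
    ; ⁻¹-cong = cong inv
    }
  }
  where open FinGroup G

module RightCosets (G : FinGroup) {Q : Subset (FinGroup.n G)} (Q≤G : IsSubgroup G Q) where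
  open FinGroup G
  open GroupProperties (toGroup G)

  e∈Q : e ∈ Q
  e∈Q = proj₁ Q≤G

  ·-closed : ∀ {a b} → a ∈ Q → b ∈ Q → a · b ∈ Q
  ·-closed = proj₁ (proj₂ Q≤G) _ _

  inv-closed : ∀ {a} → a ∈ Q → inv a ∈ Q
  inv-closed = proj₂ (proj₂ Q≤G) _

  infix 4 _~_ _~?_
  _~_ : Fin n → Fin n → Set
  g ~ h = g · inv h ∈ Q

  _~?_ : ∀ g h → Dec (g ~ h)
  g ~? h = g · inv h ∈? Q

  ~-refl : ∀ {g} → g ~ g
  ~-refl {g} = subst (_∈ Q) (sym (invʳ g)) e∈Q

  ~-sym : ∀ {g h} → g ~ h → h ~ g
  ~-sym {g} {h} g~h = subst (_∈ Q) eq (inv-closed g~h)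
    where
    eq : inv (g · inv h) ≡ h · inv g
    eq = trans (⁻¹-anti-homo-∙ g (inv h)) (cong (_· inv g) (⁻¹-involutive h))

  ~-trans : ∀ {a b c} → a ~ b → b ~ c → a ~ c
  ~-trans {a} {b} {c} a~b b~c = subst (_∈ Q) eq (·-closed a~b b~c)
    where
    eq : (a · inv b) · (b · inv c) ≡ a · inv c
    eq = trans (assoc a (inv b) (b · inv c)) (cong (a ·_) (\\-leftDividesʳ b (inv c)))

  ·-~ : ∀ {q} g → q ∈ Q → q · g ~ g
  ·-~ {q} g q∈Q = subst (_∈ Q) (sym (//-rightDividesʳ g q)) q∈Q

  ~-·ʳ : ∀ {a b} c → a ~ b → a · c ~ b · c
  ~-·ʳ {a} {b} c a~b = subst (_∈ Q) (sym eq) a~b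
    where
    open ≡-Reasoning
    eq : (a · c) · inv (b · c) ≡ a · inv b
    eq = begin
      (a · c) · inv (b · c)      ≡⟨ cong ((a · c) ·_) (⁻¹-anti-homo-∙ b c) ⟩
      (a · c) · (inv c · inv b)  ≡⟨ assoc a c (inv c · inv b) ⟩
      a · (c · (inv c · inv b))  ≡⟨ cong (a ·_) (\\-leftDividesˡ c (inv b)) ⟩
      a · inv b                  ∎

  ∈-RightCoset⁻ : ∀ {g h} → g ∈ RightCoset G Q h → g ~ h
  ∈-RightCoset⁻ {h = h} g∈Qh with q , q∈Q , refl ← ∈-decSubset⁻ (inRightCoset? G Q h) g∈Qh =
    ·-~ h q∈Q

  ∈-RightCoset⁺ : ∀ {g h} → g ~ h → g ∈ RightCoset G Q h
  ∈-RightCoset⁺ {g} {h} g~h =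
    ∈-decSubset⁺ (inRightCoset? G Q h) (g · inv h , g~h , sym (//-rightDividesˡ h g))

-- The inverse-closed double coset Δ = QxQ

module InverseClosedDoubleCoset
  (G : FinGroup) {Q : Subset (FinGroup.n G)} (Q≤G : IsSubgroup G Q)
  (x : Fin (FinGroup.n G)) (Δ-inv : InverseClosed G (DoubleCoset G Q x)) where
  open FinGroup G
  open GroupProperties (toGroup G)
  open RightCosets G Q≤G

  Δ : Subset n
  Δ = DoubleCoset G Q x

  ∈Δ⁺ : ∀ {q q'} → q ∈ Q → q' ∈ Q → q · x · q' ∈ Δ
  ∈Δ⁺ q∈Q q'∈Q = ∈-decSubset⁺ (inDoubleCoset? G Q x) (_ , _ , q∈Q , q'∈Q , refl)

  ∈Δ⁻ : ∀ {g} → g ∈ Δ → ∃ λ q → ∃ λ q' → q ∈ Q × q' ∈ Q × g ≡ q · x · q'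
  ∈Δ⁻ = ∈-decSubset⁻ (inDoubleCoset? G Q x)

  x∈Δ : x ∈ Δ
  x∈Δ = subst (_∈ Δ) (trans (idʳ (e · x)) (idˡ x)) (∈Δ⁺ e∈Q e∈Q)

  inv-∈Δ : ∀ {g} → g ∈ Δ → inv g ∈ Δ
  inv-∈Δ {g} = proj₁ (Δ-inv g)

  ~-closed : ∀ {g h} → g ~ h → h ∈ Δ → g ∈ Δ
  ~-closed {g} g~h h∈Δ with q , q' , q∈Q , q'∈Q , refl ← ∈Δ⁻ h∈Δ =
    subst (_∈ Δ) eq (∈Δ⁺ (·-closed g~h q∈Q) q'∈Q)
    where
    h = q · x · q'
    eq : (g · inv h) · q · x · q' ≡ g
    eq = trans (cong (_· q') (assoc (g · inv h) q x))
           (trans (assoc (g · inv h) (q · x) q') (//-rightDividesˡ h g))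

  InvolutionModQ : Pred (Fin n) _
  InvolutionModQ g = g · g ∈ Q

  -- `inv g ~ g` unfolds to `InvolutionModQ (inv g)`.
  inv~ : ∀ {g} → InvolutionModQ g → inv g ~ g
  inv~ {g} g²∈Q = subst (_∈ Q) (⁻¹-anti-homo-∙ g g) (inv-closed g²∈Q)

  conj-InvolutionModQ : ∀ {q w} → q ∈ Q → InvolutionModQ w → InvolutionModQ (inv q · w · q)
  conj-InvolutionModQ {q} {w} q∈Q w²∈Q =
    subst (_∈ Q) eq (·-closed (·-closed (inv-closed q∈Q) w²∈Q) q∈Q)
    where
    open ≡-Reasoning
    eq : (inv q · (w · w)) · q ≡ (inv q · w · q) · (inv q · w · q)
    eq = sym (begin
      (inv q · w · q) · (inv q · w · q)  ≡⟨ assoc (inv q · w) q (inv q · w · q) ⟩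
      (inv q · w) · (q · (inv q · w · q)) ≡⟨ cong ((inv q · w) ·_) (sym (assoc q (inv q · w) q)) ⟩
      (inv q · w) · (q · (inv q · w) · q) ≡⟨ cong (λ z → (inv q · w) · (z · q)) (\\-leftDividesˡ q w) ⟩
      (inv q · w) · (w · q)              ≡⟨ sym (assoc (inv q · w) w q) ⟩
      (inv q · w) · w · q                ≡⟨ cong (_· q) (assoc (inv q) w w) ⟩
      inv q · (w · w) · q                ∎)

  involution-in-Qx : ∃ λ w → w ~ x × InvolutionModQ w
  involution-in-Qx with p , p' , p∈Q , p'∈Q , x⁻¹≡pxp' ← ∈Δ⁻ (inv-∈Δ x∈Δ) =
    p · x , ·-~ x p∈Q , subst (_∈ Q) eq (·-closed p∈Q (inv-closed p'∈Q))
    where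
    open ≡-Reasoning
    xpx≡p'⁻¹ : x · p · x ≡ inv p'
    xpx≡p'⁻¹ = inverseˡ-unique (x · p · x) p' (begin
      x · p · x · p'       ≡⟨ assoc (x · p) x p' ⟩
      (x · p) · (x · p')   ≡⟨ assoc x p (x · p') ⟩
      x · (p · (x · p'))   ≡⟨ cong (x ·_) (sym (assoc p x p')) ⟩
      x · (p · x · p')     ≡⟨ cong (x ·_) (sym x⁻¹≡pxp') ⟩
      x · inv x            ≡⟨ invʳ x ⟩
      e                    ∎)
    eq : p · inv p' ≡ (p · x) · (p · x)
    eq = sym (trans (assoc p x (p · x)) (cong (p ·_) (trans (sym (assoc x p x)) xpx≡p'⁻¹)))

  involution-in-coset : ∀ {h} → h ∈ Δ → ∃ λ g → g ~ h × InvolutionModQ g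
  involution-in-coset h∈Δ
    with q , q' , q∈Q , q'∈Q , refl ← ∈Δ⁻ h∈Δ | w , w~x , w²∈Q ← involution-in-Qx =
    inv q' · w · q' , g~h , conj-InvolutionModQ q'∈Q w²∈Q
    where
    g~h : inv q' · w · q' ~ q · x · q'
    g~h = ~-trans (~-·ʳ q' (·-~ w (inv-closed q'∈Q)))
            (~-trans (~-·ʳ q' w~x) (~-sym (~-·ʳ q' (·-~ x q∈Q))))

  IsRep : Pred (Fin n) _
  IsRep r = r ∈ Δ × InvolutionModQ r × (∀ h → h <ᶠ r → h ~ r → ¬ InvolutionModQ h)

  IsRep? : Decidable IsRep
  IsRep? r = (r ∈? Δ) ×-dec ((r · r ∈? Q) ×-dec
    all? λ h → (h <ᶠ? r) →-dec ((h ~? r) →-dec ¬? (h · h ∈? Q)))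

  rep-exists : ∀ {h} → h ∈ Δ → ∃ λ r → IsRep r × r ~ h
  rep-exists {h} h∈Δ =
    let r , (r~h , r²∈Q) , below =
          least-witness (λ g → (g ~? h) ×-dec (g · g ∈? Q)) (involution-in-coset h∈Δ)
    in r , (~-closed r~h h∈Δ , r²∈Q , λ g g<r g~r g²∈Q → below g<r (~-trans g~r r~h , g²∈Q)) , r~h

  rep-unique : ∀ {r r'} → IsRep r → IsRep r' → r ~ r' → r ≡ r'
  rep-unique {r} {r'} (_ , r²∈Q , r-least) (_ , r'²∈Q , r'-least) r~r' with <-cmp r r'
  ... | tri< r<r' _ _ = contradiction r²∈Q (r'-least r r<r' r~r')
  ... | tri≈ _ r≡r' _ = r≡r'
  ... | tri> _ _ r'<r = contradiction r'²∈Q (r-least r' r'<r (~-sym r~r'))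

  inv-rep~ : ∀ {h} → IsRep (inv h) → inv h ~ h
  inv-rep~ (_ , h⁻²∈Q , _) = h⁻²∈Q

  IsPivot : Pred (Fin n) _
  IsPivot r = IsRep r × ¬ r ~ x

  IsPivot? : Decidable IsPivot
  IsPivot? r = IsRep? r ×-dec ¬? (r ~? x)

  IsPairMin IsPairMax IsFree : Pred (Fin n) _
  IsPairMin g = g ∈ Δ × g ≤ᶠ inv g
  IsPairMax g = g ∈ Δ × inv g ≤ᶠ g
  IsFree g = IsPairMin g × ¬ IsPivot g

  IsPairMin? : Decidable IsPairMin
  IsPairMin? g = (g ∈? Δ) ×-dec (g ≤ᶠ? inv g)

  IsPairMax? : Decidable IsPairMax
  IsPairMax? g = (g ∈? Δ) ×-dec (inv g ≤ᶠ? g)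

  IsFree? : Decidable IsFree
  IsFree? g = IsPairMin? g ×-dec ¬? (IsPivot? g)

  reps pivots pairMins pairMaxs free : Subset n
  reps     = decSubset IsRep?
  pivots   = decSubset IsPivot?
  pairMins = decSubset IsPairMin?
  pairMaxs = decSubset IsPairMax?
  free     = decSubset IsFree?

  pivot-unique : ∀ {d h} → IsPivot d → IsPivot h → h ~ d → h ≡ d
  pivot-unique (d-rep , _) (h-rep , _) = rep-unique h-rep d-rep

  inv-pivot-unique : ∀ {d h} → IsPivot d → IsPivot (inv h) → h ~ d → inv h ≡ d
  inv-pivot-unique d-piv h⁻¹-piv h~d =
    pivot-unique d-piv h⁻¹-piv (~-trans (inv-rep~ (proj₁ h⁻¹-piv)) h~d)

  pivot-IsPairMin : ∀ {d} → IsPivot d → IsPairMin d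
  pivot-IsPairMin {d} ((d∈Δ , d²∈Q , d-least) , _) =
    d∈Δ , ℕ.≮⇒≥ λ d⁻¹<d → d-least (inv d) d⁻¹<d (inv~ d²∈Q) (inv~ d²∈Q)

  ∣Δ∣≤∣Q∣*∣reps∣ : ∣ Δ ∣ ≤ ∣ Q ∣ * ∣ reps ∣
  ∣Δ∣≤∣Q∣*∣reps∣ = begin
    ∣ Δ ∣                                        ≤⟨ ∣p∣≤length {f = id} (λ _ _ → id) Δ⊆Q·reps ⟩
    length Q·reps                                ≡⟨ length-cartesianProductWith _·_ (elements Q) _ ⟩
    length (elements Q) * length (elements reps) ≡⟨ cong₂ _*_ (length-elements Q) (length-elements reps) ⟩
    ∣ Q ∣ * ∣ reps ∣                             ∎
    where
    open ≤-Reasoning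
    Q·reps = cartesianProductWith _·_ (elements Q) (elements reps)
    Δ⊆Q·reps : ∀ {g} → g ∈ Δ → g ∈ₗ Q·reps
    Δ⊆Q·reps {g} g∈Δ = let r , r-rep , r~g = rep-exists g∈Δ in
      subst (_∈ₗ Q·reps) (//-rightDividesˡ r g)
        (∈-cartesianProductWith⁺ _·_ (∈-elements⁺ (~-sym r~g)) (∈-elements⁺ (∈-decSubset⁺ IsRep? r-rep)))

  b≤∣reps∣ : ∀ b → ∣ Δ ∣ ≡ b * ∣ Q ∣ → b ≤ ∣ reps ∣
  b≤∣reps∣ b ∣Δ∣≡b∣Q∣ = *-cancelʳ-≤ b ∣ reps ∣ ∣ Q ∣ {{>-nonZero 0<∣Q∣}} (begin
    b * ∣ Q ∣        ≡⟨ ∣Δ∣≡b∣Q∣ ⟨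
    ∣ Δ ∣            ≤⟨ ∣Δ∣≤∣Q∣*∣reps∣ ⟩
    ∣ Q ∣ * ∣ reps ∣ ≡⟨ *-comm ∣ Q ∣ ∣ reps ∣ ⟩
    ∣ reps ∣ * ∣ Q ∣ ∎)
    where
    open ≤-Reasoning
    0<∣Q∣ = ≤-trans (s≤s z≤n) (x∈p⇒∣p-x∣<∣p∣ e∈Q)

  rep-or-pivot : ∀ {r₀ r} → IsRep r₀ → r₀ ~ x → IsRep r → r ≡ r₀ ⊎ IsPivot r
  rep-or-pivot {r₀} {r} r₀-rep r₀~x r-rep with r ~? x
  ... | yes r~x = inj₁ (rep-unique r-rep r₀-rep (~-trans r~x (~-sym r₀~x)))
  ... | no  r≁x = inj₂ (r-rep , r≁x)

  reps⊆⁅r₀⁆∪pivots : ∀ {r₀} → IsRep r₀ → r₀ ~ x → reps ⊆ ⁅ r₀ ⁆ ∪ pivots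
  reps⊆⁅r₀⁆∪pivots {r₀} r₀-rep r₀~x {r} r∈reps
    with rep-or-pivot r₀-rep r₀~x (∈-decSubset⁻ IsRep? r∈reps)
  ... | inj₁ refl  = x∈p∪q⁺ (inj₁ (x∈⁅x⁆ r₀))
  ... | inj₂ r-piv = x∈p∪q⁺ (inj₂ (∈-decSubset⁺ IsPivot? r-piv))

  ∣reps∣≤1+∣pivots∣ : ∣ reps ∣ ≤ 1 + ∣ pivots ∣
  ∣reps∣≤1+∣pivots∣ = let r₀ , r₀-rep , r₀~x = rep-exists x∈Δ in begin
    ∣ reps ∣                ≤⟨ p⊆q⇒∣p∣≤∣q∣ (reps⊆⁅r₀⁆∪pivots r₀-rep r₀~x) ⟩
    ∣ ⁅ r₀ ⁆ ∪ pivots ∣     ≤⟨ ∣p∪q∣≤∣p∣+∣q∣ ⁅ r₀ ⁆ pivots ⟩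
    ∣ ⁅ r₀ ⁆ ∣ + ∣ pivots ∣ ≡⟨ cong (_+ ∣ pivots ∣) (∣⁅x⁆∣≡1 r₀) ⟩
    1 + ∣ pivots ∣          ∎
    where open ≤-Reasoning

  ∣free∣+∣pivots∣≤∣pairMins∣ : ∣ free ∣ + ∣ pivots ∣ ≤ ∣ pairMins ∣
  ∣free∣+∣pivots∣≤∣pairMins∣ = disjoint⇒∣p∣+∣q∣≤∣r∣ free∩pivots-empty
    (λ g∈free → ∈-decSubset⁺ IsPairMin? (proj₁ (∈-decSubset⁻ IsFree? g∈free)))
    (λ d∈pivots → ∈-decSubset⁺ IsPairMin? (pivot-IsPairMin (∈-decSubset⁻ IsPivot? d∈pivots)))
    where
    free∩pivots-empty : Empty (free ∩ pivots)
    free∩pivots-empty (g , g∈) = let g∈free , g∈pivots = x∈p∩q⁻ free pivots g∈ in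
      proj₂ (∈-decSubset⁻ IsFree? g∈free) (∈-decSubset⁻ IsPivot? g∈pivots)

  ∣pairMins∣+∣pairMins∣≤twiceC : ∣ pairMins ∣ + ∣ pairMins ∣ ≤ twiceC G Δ
  ∣pairMins∣+∣pairMins∣≤twiceC = begin
    ∣ pairMins ∣ + ∣ pairMins ∣                        ≤⟨ +-monoʳ-≤ ∣ pairMins ∣ ∣pairMins∣≤∣pairMaxs∣ ⟩
    ∣ pairMins ∣ + ∣ pairMaxs ∣                        ≡⟨ ∣p∪q∣+∣p∩q∣≡∣p∣+∣q∣ pairMins pairMaxs ⟨
    ∣ pairMins ∪ pairMaxs ∣ + ∣ pairMins ∩ pairMaxs ∣  ≤⟨ +-mono-≤ (p⊆q⇒∣p∣≤∣q∣ ∪⊆Δ) (p⊆q⇒∣p∣≤∣q∣ ∩⊆Invols) ⟩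
    ∣ Δ ∣ + ∣ Invols G Δ ∣                             ∎
    where
    open ≤-Reasoning
    inv-pairMin : ∀ {g} → g ∈ pairMins → inv g ∈ₗ elements pairMaxs
    inv-pairMin {g} g∈ = let g∈Δ , g≤g⁻¹ = ∈-decSubset⁻ IsPairMin? g∈ in
      ∈-elements⁺ (∈-decSubset⁺ IsPairMax? (inv-∈Δ g∈Δ , subst (_≤ᶠ inv g) (sym (⁻¹-involutive g)) g≤g⁻¹))
    ∣pairMins∣≤∣pairMaxs∣ : ∣ pairMins ∣ ≤ ∣ pairMaxs ∣
    ∣pairMins∣≤∣pairMaxs∣ = ≤-trans (∣p∣≤length (λ _ _ → ⁻¹-injective) inv-pairMin)
                                    (≤-reflexive (length-elements pairMaxs))
    ∪⊆Δ : pairMins ∪ pairMaxs ⊆ Δ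
    ∪⊆Δ = ∪-lub (proj₁ ∘ ∈-decSubset⁻ IsPairMin?) (proj₁ ∘ ∈-decSubset⁻ IsPairMax?)
    ∩⊆Invols : pairMins ∩ pairMaxs ⊆ Invols G Δ
    ∩⊆Invols {g} g∈ =
      let g∈pairMins , g∈pairMaxs = x∈p∩q⁻ pairMins pairMaxs g∈
          g∈Δ , g≤g⁻¹ = ∈-decSubset⁻ IsPairMin? g∈pairMins
          _ , g⁻¹≤g = ∈-decSubset⁻ IsPairMax? g∈pairMaxs
          g²≡e = trans (cong (g ·_) (sym (≤-antisym g⁻¹≤g g≤g⁻¹))) (invʳ g)
      in ∈-decSubset⁺ (λ g → (g ∈? Δ) ×-dec (g · g ≟ e)) (g∈Δ , g²≡e)

  free-bound : ∀ b → ∣ Δ ∣ ≡ b * ∣ Q ∣ → ∣ free ∣ + ∣ free ∣ + b ≤ twiceC G Δ + 1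
  free-bound b ∣Δ∣≡b∣Q∣ = begin
    f + f + b              ≤⟨ +-monoʳ-≤ (f + f) (≤-trans (b≤∣reps∣ b ∣Δ∣≡b∣Q∣) ∣reps∣≤1+∣pivots∣) ⟩
    f + f + (1 + d)        ≤⟨ +-monoʳ-≤ (f + f) (+-monoʳ-≤ 1 (m≤m+n d d)) ⟩
    f + f + (1 + (d + d))  ≡⟨ regroup f d ⟩
    (f + d) + (f + d) + 1  ≤⟨ +-monoˡ-≤ 1 (+-mono-≤ ∣free∣+∣pivots∣≤∣pairMins∣ ∣free∣+∣pivots∣≤∣pairMins∣) ⟩
    p + p + 1              ≤⟨ +-monoˡ-≤ 1 ∣pairMins∣+∣pairMins∣≤twiceC ⟩
    twiceC G Δ + 1         ∎
    where
    open ≤-Reasoning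
    f = ∣ free ∣
    d = ∣ pivots ∣
    p = ∣ pairMins ∣
    regroup : ∀ f d → f + f + (1 + (d + d)) ≡ (f + d) + (f + d) + 1
    regroup = solve-∀

  transfer : ∀ {S T} → S ⊆ Δ → InverseClosed G S → InverseClosed G T → S ∩ free ⊆ T →
             ∀ {g} → ¬ IsPivot g → ¬ IsPivot (inv g) → g ∈ S → g ∈ T
  transfer S⊆Δ S-inv T-inv S∩free⊆T {g} g-np g⁻¹-np g∈S with g ≤ᶠ? inv g
  ... | yes g≤g⁻¹ = S∩free⊆T (x∈p∩q⁺ (g∈S , ∈-decSubset⁺ IsFree? ((S⊆Δ g∈S , g≤g⁻¹) , g-np)))
  ... | no  g≰g⁻¹ = proj₂ (T-inv g) (S∩free⊆T (x∈p∩q⁺ (proj₁ (S-inv g) g∈S ,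
                      ∈-decSubset⁺ IsFree? ((inv-∈Δ (S⊆Δ g∈S) , g⁻¹≤g⁻¹⁻¹) , g⁻¹-np))))
    where
    g⁻¹≤g⁻¹⁻¹ : inv g ≤ᶠ inv (inv g)
    g⁻¹≤g⁻¹⁻¹ = subst (inv g ≤ᶠ_) (sym (⁻¹-involutive g)) (ℕ.<⇒≤ (ℕ.≰⇒> g≰g⁻¹))

  transfer-Qx : ∀ {S T} → In𝓜 G Q x S → In𝓜 G Q x T → S ∩ free ⊆ T →
                S ∩ RightCoset G Q x ⊆ T ∩ RightCoset G Q x
  transfer-Qx {S} (S⊆Δ , S-inv , _) (_ , T-inv , _) S∩free⊆T {h} h∈ = x∈p∩q⁺ (h∈T , h∈Qx)
    where
    h∈S   = proj₁ (x∈p∩q⁻ S _ h∈)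
    h∈Qx  = proj₂ (x∈p∩q⁻ S _ h∈)
    h~x   = ∈-RightCoset⁻ h∈Qx
    h∈T   = transfer S⊆Δ S-inv T-inv S∩free⊆T (λ h-piv → proj₂ h-piv h~x)
              (λ h⁻¹-piv → proj₂ h⁻¹-piv (~-trans (inv-rep~ (proj₁ h⁻¹-piv)) h~x)) h∈S

  module _ {S T : Subset n} (S∈𝓜 : In𝓜 G Q x S) (T∈𝓜 : In𝓜 G Q x T)
           (S∩free⊆T : S ∩ free ⊆ T) (T∩free⊆S : T ∩ free ⊆ S) where
    private
      S⊆Δ    = proj₁ S∈𝓜
      S-inv  = proj₁ (proj₂ S∈𝓜)
      S-even = proj₂ (proj₂ S∈𝓜)
      T⊆Δ    = proj₁ T∈𝓜
      T-inv  = proj₁ (proj₂ T∈𝓜)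
      T-even = proj₂ (proj₂ T∈𝓜)

    coset-shrinks : ∀ {d} → IsPivot d → d ∈ S → d ∉ T → T ∩ RightCoset G Q d ⊂ S ∩ RightCoset G Q d
    coset-shrinks {d} d-piv d∈S d∉T =
      T∩Qd⊆S∩Qd , d , x∈p∩q⁺ (d∈S , ∈-RightCoset⁺ ~-refl) , d∉T ∘ proj₁ ∘ x∈p∩q⁻ T _
      where
      T∩Qd⊆S∩Qd : T ∩ RightCoset G Q d ⊆ S ∩ RightCoset G Q d
      T∩Qd⊆S∩Qd {h} h∈ = x∈p∩q⁺ (h∈S , h∈Qd)
        where
        h∈T  = proj₁ (x∈p∩q⁻ T _ h∈)
        h∈Qd = proj₂ (x∈p∩q⁻ T _ h∈)
        h~d  = ∈-RightCoset⁻ h∈Qd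
        h⁻¹∈T = proj₁ (T-inv h) h∈T
        h∈S  = transfer T⊆Δ T-inv S-inv T∩free⊆S
                 (λ h-piv → d∉T (subst (_∈ T) (pivot-unique d-piv h-piv h~d) h∈T))
                 (λ h⁻¹-piv → d∉T (subst (_∈ T) (inv-pivot-unique d-piv h⁻¹-piv h~d) h⁻¹∈T))
                 h∈T

    pivot-transfer : ∀ {d} → IsPivot d → d ∈ S → d ∈ T
    pivot-transfer {d} d-piv d∈S with d ∈? T
    ... | yes d∈T = d∈T
    ... | no  d∉T = contradiction ∣T∩Qd∣≡∣S∩Qd∣ (ℕ.<⇒≢ (p⊂q⇒∣p∣<∣q∣ (coset-shrinks d-piv d∈S d∉T)))
      where
      open ≡-Reasoning
      d∈Δ = proj₁ (proj₁ d-piv)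
      T∩Qx≡S∩Qx = ⊆-antisym (transfer-Qx T∈𝓜 S∈𝓜 T∩free⊆S) (transfer-Qx S∈𝓜 T∈𝓜 S∩free⊆T)
      ∣T∩Qd∣≡∣S∩Qd∣ : ∣ T ∩ RightCoset G Q d ∣ ≡ ∣ S ∩ RightCoset G Q d ∣
      ∣T∩Qd∣≡∣S∩Qd∣ = begin
        ∣ T ∩ RightCoset G Q d ∣ ≡⟨ T-even d x d∈Δ x∈Δ ⟩
        ∣ T ∩ RightCoset G Q x ∣ ≡⟨ cong ∣_∣ T∩Qx≡S∩Qx ⟩
        ∣ S ∩ RightCoset G Q x ∣ ≡⟨ S-even x d x∈Δ d∈Δ ⟩
        ∣ S ∩ RightCoset G Q d ∣ ∎

    ⊆-from-free : S ⊆ T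
    ⊆-from-free {g} g∈S with IsPivot? g | IsPivot? (inv g)
    ... | yes g-piv | _            = pivot-transfer g-piv g∈S
    ... | no  _     | yes g⁻¹-piv  = proj₂ (T-inv g) (pivot-transfer g⁻¹-piv (proj₁ (S-inv g) g∈S))
    ... | no  g-np  | no  g⁻¹-np   = transfer S⊆Δ S-inv T-inv S∩free⊆T g-np g⁻¹-np g∈S

  ∩free-injective : ∀ {S T} → In𝓜 G Q x S → In𝓜 G Q x T → S ∩ free ≡ T ∩ free → S ≡ T
  ∩free-injective {S} {T} S∈𝓜 T∈𝓜 eq =
    ⊆-antisym (⊆-from-free S∈𝓜 T∈𝓜 (restrict eq) (restrict (sym eq)))
              (⊆-from-free T∈𝓜 S∈𝓜 (restrict (sym eq)) (restrict eq))
    where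
    restrict : ∀ {U V} → U ∩ free ≡ V ∩ free → U ∩ free ⊆ V
    restrict {U} {V} eq {g} g∈ = proj₁ (x∈p∩q⁻ V free (subst (g ∈_) eq g∈))

  length≤2^∣free∣ : ∀ {L} → Unique L → All (In𝓜 G Q x) L → length L ≤ 2 ^ ∣ free ∣
  length≤2^∣free∣ {L} L! L⊆𝓜 = begin
    length L                  ≡⟨ length-map (_∩ free) L ⟨
    length (map (_∩ free) L)  ≤⟨ Unique-⊆⇒length≤ (map⁺-injectiveOn ∩free-injectiveOn L!) image⊆ ⟩
    length (subsetsOf free)   ≡⟨ length-subsetsOf free ⟩
    2 ^ ∣ free ∣              ∎
    where
    open ≤-Reasoning
    ∩free-injectiveOn : ∀ {S T} → S ∈ₗ L → T ∈ₗ L → S ∩ free ≡ T ∩ free → S ≡ T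
    ∩free-injectiveOn S∈L T∈L = ∩free-injective (All.lookup L⊆𝓜 S∈L) (All.lookup L⊆𝓜 T∈L)
    image⊆ : map (_∩ free) L ⊆ₗ subsetsOf free
    image⊆ m with S , _ , refl ← ∈-map⁻ (_∩ free) m = ∈-subsetsOf (p∩q⊆q S free)

lemma3p4 : (G : FinGroup) (Q : Subset (FinGroup.n G)) (x : Fin (FinGroup.n G)) (b : ℕ) →
    IsSubgroup G Q →
    InverseClosed G (DoubleCoset G Q x) →
    ∣ DoubleCoset G Q x ∣ ≡ b * ∣ Q ∣ →
    (L : List (Subset (FinGroup.n G))) → Unique L → All (In𝓜 G Q x) L →
    length L * length L ≤ 2 ^ (twiceC G (DoubleCoset G Q x) + 1 ∸ b)
lemma3p4 G Q x b Q≤G Δ-inv ∣Δ∣≡b∣Q∣ L L! L⊆𝓜 = begin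
  length L * length L          ≤⟨ *-mono-≤ ∣L∣≤2^∣free∣ ∣L∣≤2^∣free∣ ⟩
  2 ^ ∣ free ∣ * 2 ^ ∣ free ∣  ≡⟨ ^-distribˡ-+-* 2 ∣ free ∣ ∣ free ∣ ⟨
  2 ^ (∣ free ∣ + ∣ free ∣)    ≤⟨ ^-monoʳ-≤ 2 (m+n≤o⇒m≤o∸n (∣ free ∣ + ∣ free ∣) (free-bound b ∣Δ∣≡b∣Q∣)) ⟩
  2 ^ (twiceC G Δ + 1 ∸ b)     ∎
  where
  open InverseClosedDoubleCoset G Q≤G x Δ-inv
  open ≤-Reasoning
  ∣L∣≤2^∣free∣ = length≤2^∣free∣ L! L⊆𝓜
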